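{- For every integer $n\ge 1$, $u(1,n)$ equals the number of partitions $\lambda$ of $n$ such that $\mathrm{rank}(\lambda)\le 0$ and $-1$ does not belong to the rank-set of $\lambda$.
   Context: A strongly unimodal sequence of weight $n$ is a sequence of positive integers $(a_1,\ldots,a_\ell)$ such that, for some $1\le k\le\ell$, $$a_1<\cdots<a_k>\cdots>a_\ell\ge 1,$$ and $\sum_i a_i=n$. Its rank is $\ell-2k+1$. $u(m,n)$ is the number of such sequences of weight $n$ and rank $m$. For a partition $\lambda$ with $\lambda_k=0$ for $k>\ell(\lambda)$: $\mathrm{rank}(\lambda)=\lambda_1-\ell(\lambda)$, and the rank-set is $\{j-\lambda_{j+1}:j\ge 0\}$. -}

module Defs where

open import Data.Nat using (ℕ; zero; suc; _≤_; _<_)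
open import Data.Integer as ℤ using (ℤ; +_)
open import Data.List using (List; []; _∷_; length)
open import Data.Nat.ListAction using (sum)
open import Data.List.Relation.Unary.All using (All)
open import Data.List.Relation.Unary.Unique.Propositional using (Unique)
open import Data.List.Membership.Propositional using (_∈_)
open import Data.Product using (Σ; ∃; _×_)
open import Function.Bundles using (_⇔_)
open import Relation.Binary.PropositionalEquality using (_≡_)
open import Relation.Nullary using (¬_)

-- 1-indexed entry of a finite sequence, padded with 0 beyond its length
-- (so at s 0 = 0 and at s i = 0 for i > length s; the convention λ_k = 0 for k > ℓ(λ)).
at : List ℕ → ℕ → ℕ
at []       _             = 0
at (x ∷ xs) zero          = 0
at (x ∷ xs) (suc zero)    = x
at (x ∷ xs) (suc (suc i)) = at xs (suc i)

SUSeq : ℕ → ℤ → List ℕ → Set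
SUSeq n m s =
  All (1 ≤_) s × sum s ≡ n ×
  ∃ λ k → 1 ≤ k × k ≤ length s ×
    (∀ i → 1 ≤ i → i < k → at s i < at s (suc i)) ×
    (∀ i → k ≤ i → i < length s → at s (suc i) < at s i) ×
    ((+ length s) ℤ.- (+ (2 Data.Nat.* k)) ℤ.+ (+ 1) ≡ m)

IsPartition : ℕ → List ℕ → Set
IsPartition n s = All (1 ≤_) s × sum s ≡ n × (∀ i → 1 ≤ i → at s (suc i) ≤ at s i)

rank : List ℕ → ℤ
rank s = (+ at s 1) ℤ.- (+ length s)

InRankSet : List ℕ → ℤ → Set
InRankSet s z = ∃ λ j → z ≡ (+ j) ℤ.- (+ at s (suc j))

HasSize : (List ℕ → Set) → ℕ → Set
HasSize P k = Σ (List (List ℕ)) λ xs → Unique xs × length xs ≡ k × (∀ s → (s ∈ xs) ⇔ P s)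

u≡ : ℤ → ℕ → ℕ → Set
u≡ m n k = HasSize (SUSeq n m) k

GoodPartition : ℕ → List ℕ → Set
GoodPartition n s = IsPartition n s × rank s ℤ.≤ (+ 0) × ¬ InRankSet s (ℤ.- (+ 1))

module Submission where

-- A rank-one strongly unimodal sequence of length 2d has its peak at position d. Reading the ascent backwards
-- from the peak and then the descent gives a "mountain": strictly decreasing positive sequences F and G of
-- length d with G₁ < F₁, of total weight n. Taking (G₁ ⋯ G_d | F₁ - 1 ⋯ F_d - 1) as a Frobenius symbol gives a
-- partition λ of n with λ₁ = G₁ + 1 ≤ F₁ = ℓ(λ), i.e. rank(λ) ≤ 0, and all arms G_i positive, which says that
-- λ_j ≠ j for every j, i.e. -1 is not in the rank-set. Both constructions are bijective, so both sides of the
-- identity count the (finitely many) mountains of weight n.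

open import Defs
open import Data.Empty using (⊥-elim)
open import Data.Integer using (+_)
import Data.Integer as ℤ
open ℤ using (_⊖_)
import Data.Integer.Properties as ℤ
open import Algebra.Properties.AbelianGroup ℤ.+-0-abelianGroup using (∙-cancelʳ)
open import Data.List
  using (List; []; _∷_; _++_; _ʳ++_; length; reverse; map; replicate; filter; deduplicate; upTo;
         cartesianProduct; cartesianProductWith)
open import Data.List.Membership.Propositional using (_∈_)
open import Data.List.Membership.Propositional.Properties
  using (∈-map⁺; ∈-map⁻; ∈-filter⁺; ∈-filter⁻; ∈-upTo⁺; ∈-cartesianProductWith⁺; ∈-cartesianProduct⁺; deduplicate-∈⇔)
open import Data.List.Properties
  using (length-++; length-map; length-replicate; length-reverse; reverse-involutive; reverse-injective;
         unfold-reverse; ++-assoc; ∷-injective; ≡-dec)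
open import Data.List.Relation.Binary.Permutation.Propositional using (↭-sym)
open import Data.List.Relation.Binary.Permutation.Propositional.Properties using (↭-reverse; All-resp-↭)
open import Data.List.Relation.Unary.All as All using (All; []; _∷_)
open import Data.List.Relation.Unary.All.Properties using (++⁺; ++⁻; map⁺; replicate⁺)
open import Data.List.Relation.Unary.Any using (here; there)
open import Data.List.Relation.Unary.Linked as Linked using (Linked; []; [-]; _∷_)
open import Data.List.Relation.Unary.Unique.Propositional using (Unique; []; _∷_)
open import Data.List.Relation.Unary.Unique.DecPropositional.Properties using (deduplicate-!)
open import Data.Nat using (ℕ; zero; suc; pred; _+_; _*_; _∸_; _≤_; _<_; _≥_; _>_; z≤n; s≤s; _<?_; _≟_)
open import Data.Nat.ListAction using (sum)
open import Data.Nat.ListAction.Properties using (sum-++; sum-↭)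
open import Data.Nat.Properties
open import Data.Nat.Tactic.RingSolver using (solve-∀)
open import Data.Product using (Σ; ∃; ∃₂; _×_; _,_; proj₁; proj₂; uncurry)
import Data.Product.Properties as ×
open import Data.Sum using (_⊎_; inj₁; inj₂)
open import Function using (flip; case_of_)
open import Function.Bundles using (_⇔_; mk⇔; Equivalence)
open import Function.Properties.Equivalence using () renaming (trans to ⇔-trans; sym to ⇔-sym)
open import Relation.Binary.Definitions using (DecidableEquality)
open import Relation.Binary.PropositionalEquality
open import Relation.Nullary using (¬_; Dec; yes; no)
open import Relation.Nullary.Decidable using (_×-dec_; map′)

open Equivalence using (to; from)

-- Relations between consecutive entries

at-zero : ∀ s → at s 0 ≡ 0
at-zero []      = refl
at-zero (_ ∷ _) = refl

at-++ˡ : ∀ v {w} i → i ≤ length v → at (v ++ w) i ≡ at v i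
at-++ˡ []      {w} zero          _         = at-zero w
at-++ˡ (_ ∷ _)     zero          _         = refl
at-++ˡ (_ ∷ _)     (suc zero)    _         = refl
at-++ˡ (_ ∷ v)     (suc (suc i)) (s≤s i≤) = at-++ˡ v (suc i) i≤

at-beyond : ∀ s i → length s ≤ i → at s (suc i) ≡ 0
at-beyond []          i             _         = refl
at-beyond (_ ∷ s)     (suc zero)    (s≤s l≤) = at-beyond s zero l≤
at-beyond (_ ∷ s)     (suc (suc i)) (s≤s l≤) = at-beyond s (suc i) l≤

LinkedOn : (ℕ → ℕ → Set) → List ℕ → ℕ → ℕ → Set
LinkedOn R s a b = ∀ i → a ≤ i → i < b → R (at s i) (at s (suc i))

module _ {R : ℕ → ℕ → Set} where

  LinkedOn-∷ : ∀ {a b} x s → 1 ≤ a → LinkedOn R (x ∷ s) (suc a) (suc b) ⇔ LinkedOn R s a b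
  LinkedOn-∷ {a = suc a} {b} x s _ = mk⇔ shrink grow
    where
    shrink : LinkedOn R (x ∷ s) (suc (suc a)) (suc b) → LinkedOn R s (suc a) b
    shrink h (suc i) a≤i i<b = h (suc (suc i)) (s≤s a≤i) (s≤s i<b)
    grow : LinkedOn R s (suc a) b → LinkedOn R (x ∷ s) (suc (suc a)) (suc b)
    grow h (suc (suc i)) (s≤s a≤i) (s≤s i<b) = h (suc i) a≤i i<b

  Linked⇔LinkedOn : ∀ s → Linked R s ⇔ LinkedOn R s 1 (length s)
  Linked⇔LinkedOn s = mk⇔ (⇒ s) (⇐ s)
    where
    ⇒ : ∀ s → Linked R s → LinkedOn R s 1 (length s)
    ⇒ (x ∷ [])    [-]     (suc zero)    _ (s≤s ())
    ⇒ (x ∷ y ∷ t) (r ∷ l) (suc zero)    _ _        = r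
    ⇒ (x ∷ y ∷ t) (r ∷ l) (suc (suc i)) _ (s≤s i<) = ⇒ (y ∷ t) l (suc i) (s≤s z≤n) i<
    ⇐ : ∀ s → LinkedOn R s 1 (length s) → Linked R s
    ⇐ []          _ = []
    ⇐ (x ∷ [])    _ = [-]
    ⇐ (x ∷ y ∷ t) h = h 1 ≤-refl (s≤s (s≤s z≤n))
                    ∷ ⇐ (y ∷ t) (to (LinkedOn-∷ x (y ∷ t) ≤-refl) (λ i 1<i i< → h i (<⇒≤ 1<i) i<))

  LinkedOn-++ˡ : ∀ v w → LinkedOn R (v ++ w) 1 (length v) ⇔ Linked R v
  LinkedOn-++ˡ v w = ⇔-trans (mk⇔ restrict extend) (⇔-sym (Linked⇔LinkedOn v))
    where
    restrict : LinkedOn R (v ++ w) 1 (length v) → LinkedOn R v 1 (length v)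
    restrict h i 1≤i i< = subst₂ R (at-++ˡ v i (<⇒≤ i<)) (at-++ˡ v (suc i) i<) (h i 1≤i i<)
    extend : LinkedOn R v 1 (length v) → LinkedOn R (v ++ w) 1 (length v)
    extend h i 1≤i i< = subst₂ R (sym (at-++ˡ v i (<⇒≤ i<))) (sym (at-++ˡ v (suc i) i<)) (h i 1≤i i<)

  LinkedOn-++ʳ : ∀ v w → LinkedOn R (v ++ w) (suc (length v)) (length (v ++ w)) ⇔ Linked R w
  LinkedOn-++ʳ []      w = ⇔-sym (Linked⇔LinkedOn w)
  LinkedOn-++ʳ (x ∷ v) w = ⇔-trans (LinkedOn-∷ x (v ++ w) (s≤s z≤n)) (LinkedOn-++ʳ v w)

  ∷-Linked : ∀ {a} l → R a (at l 1) → Linked R l → Linked R (a ∷ l)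
  ∷-Linked []      _ _ = [-]
  ∷-Linked (_ ∷ _) r l = r ∷ l

  Linked-ʳ++ : ∀ {x xs ys} → Linked R (x ∷ xs) → Linked (flip R) (x ∷ ys) → Linked (flip R) (xs ʳ++ x ∷ ys)
  Linked-ʳ++ {xs = []}     _       acc = acc
  Linked-ʳ++ {xs = _ ∷ _} (r ∷ l) acc = Linked-ʳ++ l (r ∷ acc)

  Linked-reverse⁺ : ∀ {xs} → Linked R xs → Linked (flip R) (reverse xs)
  Linked-reverse⁺ {[]}    [] = []
  Linked-reverse⁺ {_ ∷ _} l  = Linked-ʳ++ l [-]

Linked-reverse : ∀ {R} xs → Linked (flip R) (reverse xs) ⇔ Linked R xs
Linked-reverse {R} xs =
  mk⇔ (λ l → subst (Linked R) (reverse-involutive xs) (Linked-reverse⁺ l)) Linked-reverse⁺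

-- Mountains and rank-one strongly unimodal sequences

Strict : List ℕ → Set
Strict F = Linked _>_ F × All (1 ≤_) F

strict-∷ : ∀ m F → Strict (m ∷ F) ⇔ (at F 1 < m × Strict F)
strict-∷ m F = mk⇔ uncons cons
  where
  uncons : Strict (m ∷ F) → at F 1 < m × Strict F
  uncons ([-]     , 1≤m ∷ []) = 1≤m , [] , []
  uncons (r ∷ l   , _ ∷ pos)  = r , l , pos
  cons : at F 1 < m × Strict F → Strict (m ∷ F)
  cons (F₁<m , l , pos) = ∷-Linked F F₁<m l , ≤-trans (s≤s z≤n) F₁<m ∷ pos

-- Since at [] 1 = 0, both sequences are also positive.
data StrictPair : List ℕ → List ℕ → Set where
  []   : StrictPair [] []
  step : ∀ {m x F G} → at F 1 < m → at G 1 < x → StrictPair F G → StrictPair (m ∷ F) (x ∷ G)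

StrictPair⇔ : ∀ F G → StrictPair F G ⇔ (Strict F × Strict G × length F ≡ length G)
StrictPair⇔ F G = mk⇔ (⇒ F G) (⇐ F G)
  where
  ⇒ : ∀ F G → StrictPair F G → Strict F × Strict G × length F ≡ length G
  ⇒ [] [] [] = ([] , []) , ([] , []) , refl
  ⇒ (m ∷ F) (x ∷ G) (step F₁<m G₁<x pair) =
    let sF , sG , l = ⇒ F G pair
    in from (strict-∷ m F) (F₁<m , sF) , from (strict-∷ x G) (G₁<x , sG) , cong suc l
  ⇐ : ∀ F G → Strict F × Strict G × length F ≡ length G → StrictPair F G
  ⇐ []      []      _ = []
  ⇐ (m ∷ F) (x ∷ G) (sF , sG , l) =
    let F₁<m , sF′ = to (strict-∷ m F) sF
        G₁<x , sG′ = to (strict-∷ x G) sG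
    in step F₁<m G₁<x (⇐ F G (sF′ , sG′ , suc-injective l))

-- F is the ascent of the sequence read downwards from the peak, G the descent after the peak.
Mountain : ℕ → List ℕ × List ℕ → Set
Mountain n (F , G) = StrictPair F G × at G 1 < at F 1 × sum F + sum G ≡ n

unimodal : List ℕ × List ℕ → List ℕ
unimodal (F , G) = reverse F ++ G

unimodal-peak : ∀ p F′ G → unimodal (p ∷ F′ , G) ≡ reverse F′ ++ p ∷ G
unimodal-peak p F′ G = trans (cong (_++ G) (unfold-reverse p F′)) (++-assoc (reverse F′) (p ∷ []) G)

All-unimodal : ∀ {P : ℕ → Set} F G → All P (unimodal (F , G)) ⇔ (All P F × All P G)
All-unimodal F G = mk⇔
  (λ a → let aF , aG = ++⁻ (reverse F) a in All-resp-↭ (↭-reverse F) aF , aG)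
  (λ (aF , aG) → ++⁺ (All-resp-↭ (↭-sym (↭-reverse F)) aF) aG)

sum-unimodal : ∀ F G → sum (unimodal (F , G)) ≡ sum F + sum G
sum-unimodal F G = trans (sum-++ (reverse F) G) (cong (_+ sum G) (sum-↭ (↭-reverse F)))

length-unimodal : ∀ F G → length (unimodal (F , G)) ≡ length F + length G
length-unimodal F G = trans (length-++ (reverse F)) (cong (_+ length G) (length-reverse F))

ascent⇔ : ∀ F G → LinkedOn _<_ (unimodal (F , G)) 1 (length F) ⇔ Linked _>_ F
ascent⇔ F G = ⇔-trans
  (subst (λ k → LinkedOn _<_ (unimodal (F , G)) 1 k ⇔ Linked _<_ (reverse F))
         (length-reverse F) (LinkedOn-++ˡ (reverse F) G))
  (Linked-reverse F)

descent⇔ : ∀ p F′ G → let s = unimodal (p ∷ F′ , G) in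
           LinkedOn _>_ s (length (p ∷ F′)) (length s) ⇔ Linked _>_ (p ∷ G)
descent⇔ p F′ G rewrite unimodal-peak p F′ G =
  subst (λ k → LinkedOn _>_ (reverse F′ ++ p ∷ G) (suc k) (length (reverse F′ ++ p ∷ G)) ⇔ Linked _>_ (p ∷ G))
        (length-reverse F′) (LinkedOn-++ʳ (reverse F′) (p ∷ G))

2*k≡k+k : ∀ k → 2 * k ≡ k + k
2*k≡k+k k = cong (_+_ k) (+-identityʳ k)

rank-one⇔ : ∀ l k → ((+ l) ℤ.- (+ (2 * k)) ℤ.+ (+ 1) ≡ + 1) ⇔ (l ≡ k + k)
rank-one⇔ l k = mk⇔
  (λ e → trans (ℤ.+-injective (ℤ.i-j≡0⇒i≡j (+ l) _ (∙-cancelʳ (+ 1) _ (+ 0) e))) (2*k≡k+k k))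
  (λ { refl → cong (ℤ._+ (+ 1)) (trans (cong (λ m → + (k + k) ℤ.- + m) (2*k≡k+k k)) (ℤ.+-inverseʳ (+ (k + k)))) })

mountain⇒SUSeq : ∀ {n} P → Mountain n P → SUSeq n (+ 1) (unimodal P)
mountain⇒SUSeq ([] , []) ([] , () , _)
mountain⇒SUSeq (p ∷ F′ , G) (pair , G₁<p , Σ≡n) with to (StrictPair⇔ (p ∷ F′) G) pair
... | (ascF , posF) , strictG@(_ , posG) , ∣F∣≡∣G∣ =
  from (All-unimodal F G) (posF , posG) , trans (sum-unimodal F G) Σ≡n ,
  length F , s≤s z≤n , subst (length F ≤_) (sym ∣s∣≡) (m≤m+n (length F) (length G)) ,
  from (ascent⇔ F G) ascF , from (descent⇔ p F′ G) (proj₁ (from (strict-∷ p G) (G₁<p , strictG))) ,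
  from (rank-one⇔ (length s) (length F)) (trans ∣s∣≡ (cong (_+_ (length F)) (sym ∣F∣≡∣G∣)))
  where
  F = p ∷ F′
  s = unimodal (F , G)
  ∣s∣≡ = length-unimodal F G

split-at-peak : ∀ c s → c < length s → ∃₂ λ p F′ → ∃ λ G → s ≡ unimodal (p ∷ F′ , G) × length F′ ≡ c
split-at-peak c s c<∣s∣ =
  let v , p , G , s≡ , ∣v∣≡c = split c s c<∣s∣
  in p , reverse v , G ,
     trans s≡ (sym (trans (unimodal-peak p (reverse v) G) (cong (_++ p ∷ G) (reverse-involutive v)))) ,
     trans (length-reverse v) ∣v∣≡c
  where
  split : ∀ c s → c < length s → ∃₂ λ v p → ∃ λ G → s ≡ v ++ p ∷ G × length v ≡ c
  split zero    (p ∷ G) _         = [] , p , G , refl , refl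
  split (suc c) (x ∷ s) (s≤s c<) =
    let v , p , G , s≡ , ∣v∣≡c = split c s c< in x ∷ v , p , G , cong (x ∷_) s≡ , cong suc ∣v∣≡c

SUSeq⇒mountain : ∀ {n} s → SUSeq n (+ 1) s → ∃ λ P → Mountain n P × unimodal P ≡ s
SUSeq⇒mountain s (pos , Σ≡n , suc c , _ , k≤∣s∣ , asc , desc , rank) with split-at-peak c s k≤∣s∣
... | p , F′ , G , refl , refl with to (All-unimodal (p ∷ F′) G) pos
... | posF@(1≤p ∷ _) , posG with to (strict-∷ p G) (to (descent⇔ p F′ G) desc , 1≤p ∷ posG)
... | G₁<p , strictG =
  (F , G) , (from (StrictPair⇔ F G) (strictF , strictG , ∣F∣≡∣G∣) , G₁<p , trans (sym (sum-unimodal F G)) Σ≡n) , refl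
  where
  F = p ∷ F′
  strictF : Strict F
  strictF = to (ascent⇔ F G) asc , posF
  ∣F∣≡∣G∣ : length F ≡ length G
  ∣F∣≡∣G∣ = sym (+-cancelˡ-≡ (length F) _ _
              (trans (sym (length-unimodal F G)) (to (rank-one⇔ (length (unimodal (F , G))) (length F)) rank)))

++-cancel-length : ∀ (u v : List ℕ) {w x} → length u ≡ length v → u ++ w ≡ v ++ x → u ≡ v × w ≡ x
++-cancel-length []      []      _ e = refl , e
++-cancel-length (a ∷ u) (b ∷ v) l e =
  let a≡b , e′ = ∷-injective e
      u≡v , w≡x = ++-cancel-length u v (suc-injective l) e′
  in cong₂ _∷_ a≡b u≡v , w≡x

unimodal-injective : ∀ {n n′ P P′} → Mountain n P → Mountain n′ P′ → unimodal P ≡ unimodal P′ → P ≡ P′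
unimodal-injective {P = F , G} {F′ , G′} (pair , _) (pair′ , _) s≡s′ =
  let rF≡rF′ , G≡G′ = ++-cancel-length (reverse F) (reverse F′) ∣rF∣≡∣rF′∣ s≡s′
  in cong₂ _,_ (reverse-injective rF≡rF′) G≡G′
  where
  ∣s∣≡∣F∣+∣F∣ : ∀ F G → StrictPair F G → length (unimodal (F , G)) ≡ length F + length F
  ∣s∣≡∣F∣+∣F∣ F G pair =
    trans (length-unimodal F G) (cong (_+_ (length F)) (sym (proj₂ (proj₂ (to (StrictPair⇔ F G) pair)))))
  ∣F∣≡∣F′∣ : length F ≡ length F′
  ∣F∣≡∣F′∣ = *-cancelˡ-≡ _ _ 2 (begin
    2 * length F              ≡⟨ 2*k≡k+k (length F) ⟩
    length F + length F       ≡⟨ sym (∣s∣≡∣F∣+∣F∣ F G pair) ⟩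
    length (unimodal (F , G)) ≡⟨ cong length s≡s′ ⟩
    length (unimodal (F′ , G′)) ≡⟨ ∣s∣≡∣F∣+∣F∣ F′ G′ pair′ ⟩
    length F′ + length F′     ≡⟨ sym (2*k≡k+k (length F′)) ⟩
    2 * length F′             ∎)
    where open ≡-Reasoning
  ∣rF∣≡∣rF′∣ : length (reverse F) ≡ length (reverse F′)
  ∣rF∣≡∣rF′∣ = trans (length-reverse F) (trans ∣F∣≡∣F′∣ (sym (length-reverse F′)))

-- Partitions from Frobenius symbols

FixedPointFree : List ℕ → Set
FixedPointFree l = ∀ j → at l (suc j) ≢ suc j

-1≡j-a⇔ : ∀ j a → (ℤ.- (+ 1) ≡ (+ j) ℤ.- (+ a)) ⇔ (a ≡ suc j)
-1≡j-a⇔ j a = mk⇔ (λ e → ⊖≡-1 j a (sym (trans e (ℤ.m-n≡m⊖n j a)))) (λ { refl → sym (⊖1+≡-1 j) })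
  where
  ⊖≡-1 : ∀ j a → j ⊖ a ≡ ℤ.-[1+ 0 ] → a ≡ suc j
  ⊖≡-1 zero    (suc zero)    _ = refl
  ⊖≡-1 (suc j) (suc a)       e = cong suc (⊖≡-1 j a (trans (sym (ℤ.[1+m]⊖[1+n]≡m⊖n j a)) e))
  ⊖≡-1 zero    zero          ()
  ⊖≡-1 zero    (suc (suc _)) ()
  ⊖≡-1 (suc _) zero          ()
  ⊖1+≡-1 : ∀ j → j ⊖ suc j ≡ ℤ.-[1+ 0 ]
  ⊖1+≡-1 zero    = refl
  ⊖1+≡-1 (suc j) = trans (ℤ.[1+m]⊖[1+n]≡m⊖n j (suc j)) (⊖1+≡-1 j)

∉rankSet⇔fixedPointFree : ∀ l → (¬ InRankSet l (ℤ.- (+ 1))) ⇔ FixedPointFree l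
∉rankSet⇔fixedPointFree l = mk⇔
  (λ ∉ j fixed → ∉ (j , from (-1≡j-a⇔ j _) fixed))
  (λ free (j , e) → free j (to (-1≡j-a⇔ j _) e))

rank≤0⇔ : ∀ l → (rank l ℤ.≤ + 0) ⇔ (at l 1 ≤ length l)
rank≤0⇔ l = mk⇔ (λ r → ℤ.drop‿+≤+ (ℤ.i-j≤0⇒i≤j r)) (λ l₁≤ → ℤ.i≤j⇒i-j≤0 (ℤ.+≤+ l₁≤))

antitone⇔Linked : ∀ l → (∀ i → 1 ≤ i → at l (suc i) ≤ at l i) ⇔ Linked _≥_ l
antitone⇔Linked l = mk⇔
  (λ h → from (Linked⇔LinkedOn l) (λ i 1≤i _ → h i 1≤i))
  (λ lk i 1≤i → case i <? length l of λ where
     (yes i<) → to (Linked⇔LinkedOn l) lk i 1≤i i<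
     (no  i≮) → subst (_≤ at l i) (sym (at-beyond l i (≮⇒≥ i≮))) z≤n)

addColumn : List ℕ → ℕ → List ℕ
addColumn κ r = map suc κ ++ replicate r 1

length-addColumn : ∀ κ r → length (addColumn κ r) ≡ length κ + r
length-addColumn κ r = trans (length-++ (map suc κ)) (cong₂ _+_ (length-map suc κ) (length-replicate r))

sum-addColumn : ∀ κ r → sum (addColumn κ r) ≡ sum κ + length (addColumn κ r)
sum-addColumn κ r = begin
  sum (map suc κ ++ replicate r 1)           ≡⟨ sum-++ (map suc κ) _ ⟩
  sum (map suc κ) + sum (replicate r 1)      ≡⟨ cong₂ _+_ (sum-map-suc κ) (sum-ones r) ⟩
  sum κ + length κ + r                       ≡⟨ +-assoc (sum κ) (length κ) r ⟩
  sum κ + (length κ + r)                     ≡⟨ cong (_+_ (sum κ)) (length-addColumn κ r) ⟨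
  sum κ + length (addColumn κ r)             ∎
  where
  open ≡-Reasoning
  sum-map-suc : ∀ κ → sum (map suc κ) ≡ sum κ + length κ
  sum-map-suc []      = refl
  sum-map-suc (k ∷ κ) = begin
    suc k + sum (map suc κ)      ≡⟨ cong (_+_ (suc k)) (sum-map-suc κ) ⟩
    suc (k + (sum κ + length κ)) ≡⟨ cong suc (+-assoc k (sum κ) (length κ)) ⟨
    suc (k + sum κ + length κ)   ≡⟨ +-suc (k + sum κ) (length κ) ⟨
    k + sum κ + suc (length κ)   ∎
  sum-ones : ∀ r → sum (replicate r 1) ≡ r
  sum-ones zero    = refl
  sum-ones (suc r) = cong suc (sum-ones r)

addColumn-positive : ∀ κ r → All (1 ≤_) (addColumn κ r)
addColumn-positive κ r = ++⁺ (map⁺ (All.universal (λ _ → s≤s z≤n) κ)) (replicate⁺ r ≤-refl)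

at-addColumn : ∀ κ r i → at (addColumn κ r) i ≡ suc (at κ i) ⊎ (at (addColumn κ r) i ≤ 1 × at κ i ≡ 0)
at-addColumn []      r       i             = inj₂ (ones≤1 r i , refl)
  where
  ones≤1 : ∀ r i → at (replicate r 1) i ≤ 1
  ones≤1 zero    _             = z≤n
  ones≤1 (suc r) zero          = z≤n
  ones≤1 (suc r) (suc zero)    = ≤-refl
  ones≤1 (suc r) (suc (suc i)) = ones≤1 r (suc i)
at-addColumn (k ∷ κ) r zero          = inj₂ (z≤n , refl)
at-addColumn (k ∷ κ) r (suc zero)    = inj₁ refl
at-addColumn (k ∷ κ) r (suc (suc i)) = at-addColumn κ r (suc i)

at₁-addColumn : ∀ κ r → at (addColumn κ r) 1 ≤ suc (at κ 1)
at₁-addColumn κ r with at-addColumn κ r 1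
... | inj₁ eq       = ≤-reflexive eq
... | inj₂ (≤1 , _) = ≤-trans ≤1 (s≤s z≤n)

addColumn-Linked : ∀ κ r → Linked _≥_ κ → Linked _≥_ (addColumn κ r)
addColumn-Linked []      r       _  = ones r
  where
  ones : ∀ r → Linked _≥_ (replicate r 1)
  ones zero          = []
  ones (suc zero)    = [-]
  ones (suc (suc r)) = ≤-refl ∷ ones (suc r)
addColumn-Linked (k ∷ κ) r lk =
  ∷-Linked (addColumn κ r) (≤-trans (at₁-addColumn κ r) (s≤s (κ₁≤k κ lk))) (addColumn-Linked κ r (Linked.tail lk))
  where
  κ₁≤k : ∀ κ → Linked _≥_ (k ∷ κ) → at κ 1 ≤ k
  κ₁≤k []      _       = z≤n
  κ₁≤k (_ ∷ _) (r ∷ _) = r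

addColumn-injective : ∀ κ κ′ {r r′} → All (1 ≤_) κ → All (1 ≤_) κ′ → addColumn κ r ≡ addColumn κ′ r′ → κ ≡ κ′
addColumn-injective []      []                _          _          _ = refl
addColumn-injective []      (k′ ∷ κ′) {suc r} _          (1≤k′ ∷ _) e =
  ⊥-elim (<-irrefl (suc-injective (proj₁ (∷-injective e))) 1≤k′)
addColumn-injective (k ∷ κ) []        {r′ = suc r′} (1≤k ∷ _) _ e =
  ⊥-elim (<-irrefl (sym (suc-injective (proj₁ (∷-injective e)))) 1≤k)
addColumn-injective (k ∷ κ) (k′ ∷ κ′) (_ ∷ pos) (_ ∷ pos′) e =
  let k≡k′ , e′ = ∷-injective e
  in cong₂ _∷_ (suc-injective k≡k′) (addColumn-injective κ κ′ pos pos′ e′)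

removeColumn : ∀ b l → Linked _≥_ (suc b ∷ l) → All (1 ≤_) l →
               ∃₂ λ κ r → l ≡ addColumn κ r × Linked _≥_ κ × All (1 ≤_) κ × at κ 1 ≤ b
removeColumn b []                 _        _         = [] , 0 , refl , [] , [] , z≤n
removeColumn b (suc zero ∷ l)     (_ ∷ lk) (_ ∷ pos) = [] , suc (length l) , cong (1 ∷_) (ones l lk pos) , [] , [] , z≤n
  where
  ones : ∀ l → Linked _≥_ (1 ∷ l) → All (1 ≤_) l → l ≡ replicate (length l) 1
  ones []              _        _         = refl
  ones (suc zero ∷ l)  (_ ∷ lk) (_ ∷ pos) = cong (1 ∷_) (ones l lk pos)
  ones (suc (suc _) ∷ _) (s≤s () ∷ _) _
removeColumn b (suc (suc z) ∷ l) (s≤s 1+z≤b ∷ lk) (_ ∷ pos) =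
  let κ , r , l≡ , lkκ , posκ , κ₁≤1+z = removeColumn (suc z) l lk pos
  in suc z ∷ κ , r , cong (suc (suc z) ∷_) l≡ , ∷-Linked κ κ₁≤1+z lkκ , s≤s z≤n ∷ posκ , 1+z≤b

-- The partition with Frobenius symbol (x₁ ⋯ x_d | m₁ - 1 ⋯ m_d - 1), built from its innermost hook outwards:
-- the hook with arm x and leg m - 1 becomes a new first row and first column.
fromFrobenius : List ℕ → List ℕ → List ℕ
fromFrobenius (m ∷ F) (x ∷ G) = suc x ∷ addColumn (fromFrobenius F G) (pred m ∸ length (fromFrobenius F G))
fromFrobenius _       _       = []

length-fromFrobenius : ∀ {F G} → StrictPair F G → length (fromFrobenius F G) ≡ at F 1
length-fromFrobenius []                                = refl
length-fromFrobenius (step {m = suc m} {F = F} {G} F₁≤m _ pair) =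
  cong suc (trans (length-addColumn κ (m ∸ length κ)) (m+[n∸m]≡n ∣κ∣≤m))
  where
  κ = fromFrobenius F G
  ∣κ∣≤m : length κ ≤ m
  ∣κ∣≤m = subst (_≤ m) (sym (length-fromFrobenius pair)) (≤-pred F₁≤m)

sum-fromFrobenius : ∀ {F G} → StrictPair F G → sum (fromFrobenius F G) ≡ sum F + sum G
sum-fromFrobenius []                                      = refl
sum-fromFrobenius p@(step {m = m} {x} {F} {G} _ _ pair) = begin
  suc x + sum (addColumn κ r)          ≡⟨ cong (_+_ (suc x)) (sum-addColumn κ r) ⟩
  suc x + (sum κ + h)                  ≡⟨ cong (λ t → suc x + (t + h)) (sum-fromFrobenius pair) ⟩
  suc x + (sum F + sum G + h)          ≡⟨ regroup x h (sum F) (sum G) ⟩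
  suc h + sum F + (x + sum G)          ≡⟨ cong (λ m → m + sum F + (x + sum G)) (length-fromFrobenius p) ⟩
  m + sum F + (x + sum G)              ∎
  where
  open ≡-Reasoning
  κ = fromFrobenius F G
  r = pred m ∸ length κ
  h = length (addColumn κ r)
  regroup : ∀ x h a b → suc x + (a + b + h) ≡ suc h + a + (x + b)
  regroup = solve-∀

fromFrobenius-positive : ∀ F G → All (1 ≤_) (fromFrobenius F G)
fromFrobenius-positive []      _       = []
fromFrobenius-positive (_ ∷ _) []      = []
fromFrobenius-positive (m ∷ F) (x ∷ G) = s≤s z≤n ∷ addColumn-positive κ (pred m ∸ length κ)
  where κ = fromFrobenius F G

fromFrobenius-Linked : ∀ {F G} → StrictPair F G → Linked _≥_ (fromFrobenius F G)
fromFrobenius-Linked []                                   = []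
fromFrobenius-Linked (step {x = x} {F} {G} _ G₁<x pair) =
  ∷-Linked (addColumn κ _) (≤-trans (at₁-addColumn κ _) (s≤s (κ₁≤x pair G₁<x))) (addColumn-Linked κ _ (fromFrobenius-Linked pair))
  where
  κ = fromFrobenius F G
  κ₁≤x : ∀ {F G} → StrictPair F G → at G 1 < x → at (fromFrobenius F G) 1 ≤ x
  κ₁≤x []             _    = z≤n
  κ₁≤x (step _ _ _) G₁<x = G₁<x

fromFrobenius-fixedPointFree : ∀ {F G} → StrictPair F G → FixedPointFree (fromFrobenius F G)
fromFrobenius-fixedPointFree (step _ G₁<x _) zero e = <-irrefl (sym (suc-injective e)) (≤-trans (s≤s z≤n) G₁<x)
fromFrobenius-fixedPointFree (step {m = m} {F = F} {G} _ _ pair) (suc j) e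
  with at-addColumn (fromFrobenius F G) (pred m ∸ length (fromFrobenius F G)) (suc j)
... | inj₁ eq       = fromFrobenius-fixedPointFree pair j (suc-injective (trans (sym eq) e))
... | inj₂ (≤1 , _) with s≤s () ← ≤-trans (≤-reflexive (sym e)) ≤1

fromFrobenius-injective : ∀ {F G F′ G′} → StrictPair F G → StrictPair F′ G′ →
                          fromFrobenius F G ≡ fromFrobenius F′ G′ → (F , G) ≡ (F′ , G′)
fromFrobenius-injective []                   []                     _ = refl
fromFrobenius-injective p@(step {F = F} {G} _ _ pair) p′@(step {F = F′} {G′} _ _ pair′) e =
  let 1+x≡1+x′ , columns≡ = ∷-injective e
      FG≡F′G′ = fromFrobenius-injective pair pair′
        (addColumn-injective (fromFrobenius F G) (fromFrobenius F′ G′)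
           (fromFrobenius-positive F G) (fromFrobenius-positive F′ G′) columns≡)
      m≡m′ = trans (sym (length-fromFrobenius p)) (trans (cong length e) (length-fromFrobenius p′))
  in cong₂ (λ (m , x) (F , G) → (m ∷ F , x ∷ G)) (cong₂ _,_ m≡m′ (suc-injective 1+x≡1+x′)) FG≡F′G′

addColumn-fixedPointFree : ∀ {a} κ r → FixedPointFree (a ∷ addColumn κ r) → FixedPointFree κ
addColumn-fixedPointFree κ r free j κⱼ≡ with at-addColumn κ r (suc j)
... | inj₁ eq     = free (suc j) (trans eq (cong suc κⱼ≡))
... | inj₂ (_ , z) = 0≢1+n (trans (sym z) κⱼ≡)

fromFrobenius-surjective : ∀ l → Linked _≥_ l → All (1 ≤_) l → FixedPointFree l →
                           ∃₂ λ F G → StrictPair F G × fromFrobenius F G ≡ l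
fromFrobenius-surjective l = peel (length l) l ≤-refl
  where
  peel : ∀ fuel l → length l ≤ fuel → Linked _≥_ l → All (1 ≤_) l → FixedPointFree l →
         ∃₂ λ F G → StrictPair F G × fromFrobenius F G ≡ l
  peel _          []                   _                  _  _         _    = [] , [] , [] , refl
  peel (suc fuel) (zero ∷ _)           _                  _  (() ∷ _)  _
  peel (suc fuel) (suc zero ∷ _)       _                  _  _         free = ⊥-elim (free 0 refl)
  peel (suc fuel) (suc (suc y) ∷ rest) (s≤s ∣rest∣≤fuel) lk (_ ∷ pos) free
    with removeColumn (suc y) rest lk pos
  ... | κ , r , refl , lkκ , posκ , κ₁≤1+y
    with peel fuel κ (≤-trans (m≤m+n (length κ) r) (subst (_≤ fuel) (length-addColumn κ r) ∣rest∣≤fuel))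
              lkκ posκ (addColumn-fixedPointFree κ r free)
  ... | F′ , G′ , pair′ , refl =
    suc (length (addColumn κ r)) ∷ F′ , suc y ∷ G′ , step F′₁≤ (G′₁< pair′ κ₁≤1+y) pair′ ,
    cong (λ h → suc (suc y) ∷ addColumn κ h) (trans (cong (_∸ length κ) (length-addColumn κ r)) (m+n∸m≡n (length κ) r))
    where
    F′₁≤ : at F′ 1 < suc (length (addColumn κ r))
    F′₁≤ = s≤s (subst₂ _≤_ (length-fromFrobenius pair′) (sym (length-addColumn κ r)) (m≤m+n (length κ) r))
    G′₁< : ∀ {F G b} → StrictPair F G → at (fromFrobenius F G) 1 ≤ suc b → at G 1 < suc b
    G′₁< []           _ = s≤s z≤n
    G′₁< (step _ _ _) h = h

mountain⇒goodPartition : ∀ {n F G} → Mountain n (F , G) → GoodPartition n (fromFrobenius F G)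
mountain⇒goodPartition ([] , () , _)
mountain⇒goodPartition {F = m ∷ F} {x ∷ G} (pair , x<m , Σ≡n) =
  (fromFrobenius-positive (m ∷ F) (x ∷ G) , trans (sum-fromFrobenius pair) Σ≡n ,
   from (antitone⇔Linked π) (fromFrobenius-Linked pair)) ,
  from (rank≤0⇔ π) (subst (suc x ≤_) (sym (length-fromFrobenius pair)) x<m) ,
  from (∉rankSet⇔fixedPointFree π) (fromFrobenius-fixedPointFree pair)
  where
  π = fromFrobenius (m ∷ F) (x ∷ G)

goodPartition⇒mountain : ∀ {n} l → 1 ≤ n → GoodPartition n l → ∃ λ P → Mountain n P × uncurry fromFrobenius P ≡ l
goodPartition⇒mountain l n≥1 ((pos , Σ≡n , antitone) , rank≤0 , ∉rankSet)
  with fromFrobenius-surjective l (to (antitone⇔Linked l) antitone) pos (to (∉rankSet⇔fixedPointFree l) ∉rankSet)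
... | []    , []    , []   , refl = ⊥-elim (<-irrefl Σ≡n n≥1)
... | m ∷ F , x ∷ G , pair , refl =
  (m ∷ F , x ∷ G) , (pair , x<m , trans (sym (sum-fromFrobenius pair)) Σ≡n) , refl
  where
  x<m : x < m
  x<m = subst (suc x ≤_) (length-fromFrobenius pair) (to (rank≤0⇔ (fromFrobenius (m ∷ F) (x ∷ G))) rank≤0)

Enumerates : {X : Set} → (X → Set) → List X → Set
Enumerates P xs = Unique xs × (∀ a → (a ∈ xs) ⇔ P a)

map-enumerates : ∀ {X Y : Set} {P : X → Set} {Q : Y → Set} (f : X → Y) {xs} →
                 (∀ {a b} → P a → P b → f a ≡ f b → a ≡ b) →
                 (∀ {a} → P a → Q (f a)) →
                 (∀ {b} → Q b → ∃ λ a → P a × f a ≡ b) →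
                 Enumerates P xs → Enumerates Q (map f xs)
map-enumerates {P = P} {Q} f {xs} injective P⇒Q Q⇒P (unique , mem) =
  map-unique xs unique (All.tabulate (λ {a} a∈ → to (mem a) a∈)) , λ b → mk⇔
    (λ b∈ → let a , a∈ , b≡ = ∈-map⁻ f b∈ in subst Q (sym b≡) (P⇒Q (to (mem a) a∈)))
    (λ qb → let a , pa , fa≡b = Q⇒P qb in subst (_∈ map f xs) fa≡b (∈-map⁺ f (from (mem a) pa)))
  where
  map-unique : ∀ xs → Unique xs → All P xs → Unique (map f xs)
  map-unique []       []              []        = []
  map-unique (a ∷ xs) (a∉xs ∷ unique) (pa ∷ ps) =
    map⁺ (All.zipWith (λ (a≢b , pb) fa≡fb → a≢b (injective pa pb fa≡fb)) (a∉xs , ps)) ∷ map-unique xs unique ps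

-- Counting

boundedLists : ℕ → ℕ → List (List ℕ)
boundedLists zero    b = [] ∷ []
boundedLists (suc L) b = [] ∷ cartesianProductWith _∷_ (upTo (suc b)) (boundedLists L b)

∈-boundedLists : ∀ {L b} l → length l ≤ L → All (_≤ b) l → l ∈ boundedLists L b
∈-boundedLists {zero}  []      _          _          = here refl
∈-boundedLists {suc L} []      _          _          = here refl
∈-boundedLists {suc L} (k ∷ l) (s≤s ∣l∣≤) (k≤b ∷ l≤b) =
  there (∈-cartesianProductWith⁺ _∷_ (∈-upTo⁺ (s≤s k≤b)) (∈-boundedLists l ∣l∣≤ l≤b))

∈-boundedLists-sum : ∀ {n} l → All (1 ≤_) l → sum l ≤ n → l ∈ boundedLists n n
∈-boundedLists-sum l pos Σ≤n =
  ∈-boundedLists l (≤-trans (length≤sum l pos) Σ≤n) (All.map (λ k≤Σ → ≤-trans k≤Σ Σ≤n) (entries≤sum l))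
  where
  length≤sum : ∀ l → All (1 ≤_) l → length l ≤ sum l
  length≤sum []      []          = z≤n
  length≤sum (k ∷ l) (1≤k ∷ pos) = +-mono-≤ 1≤k (length≤sum l pos)
  entries≤sum : ∀ l → All (_≤ sum l) l
  entries≤sum []      = []
  entries≤sum (k ∷ l) = m≤m+n k (sum l) ∷ All.map (λ k′≤ → ≤-trans k′≤ (m≤n+m (sum l) k)) (entries≤sum l)

strictPair? : ∀ F G → Dec (StrictPair F G)
strictPair? []      []      = yes []
strictPair? []      (_ ∷ _) = no λ ()
strictPair? (_ ∷ _) []      = no λ ()
strictPair? (m ∷ F) (x ∷ G) =
  map′ (λ (F₁<m , G₁<x , pair) → step F₁<m G₁<x pair) (λ { (step F₁<m G₁<x pair) → F₁<m , G₁<x , pair })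
       (at F 1 <? m ×-dec at G 1 <? x ×-dec strictPair? F G)

mountain? : ∀ n P → Dec (Mountain n P)
mountain? n (F , G) = strictPair? F G ×-dec at G 1 <? at F 1 ×-dec sum F + sum G ≟ n

_≟ₚ_ : DecidableEquality (List ℕ × List ℕ)
_≟ₚ_ = ×.≡-dec (≡-dec _≟_) (≡-dec _≟_)

mountains : ℕ → List (List ℕ × List ℕ)
mountains n = deduplicate _≟ₚ_ (filter (mountain? n) (cartesianProduct (boundedLists n n) (boundedLists n n)))

mountains-enumerates : ∀ n → Enumerates (Mountain n) (mountains n)
mountains-enumerates n = deduplicate-! _≟ₚ_ _ , λ P → mk⇔
  (λ P∈ → proj₂ (∈-filter⁻ (mountain? n) {xs = candidates} (from (deduplicate-∈⇔ _≟ₚ_) P∈)))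
  (λ mP → to (deduplicate-∈⇔ _≟ₚ_) (∈-filter⁺ (mountain? n) (bounded P mP) mP))
  where
  candidates = cartesianProduct (boundedLists n n) (boundedLists n n)
  bounded : ∀ P → Mountain n P → P ∈ candidates
  bounded (F , G) (pair , _ , Σ≡n) =
    let (_ , posF) , (_ , posG) , _ = to (StrictPair⇔ F G) pair
    in ∈-cartesianProduct⁺ (∈-boundedLists-sum F posF (≤-trans (m≤m+n (sum F) (sum G)) (≤-reflexive Σ≡n)))
                           (∈-boundedLists-sum G posG (≤-trans (m≤n+m (sum G) (sum F)) (≤-reflexive Σ≡n)))

lemma4p1 : (n : ℕ) → 1 ≤ n → Σ ℕ (λ k → u≡ (+ 1) n k × HasSize (GoodPartition n) k)
lemma4p1 n n≥1 =
  length (mountains n) ,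
  size unimodal (map-enumerates unimodal unimodal-injective
                   (mountain⇒SUSeq _) (SUSeq⇒mountain _) (mountains-enumerates n)) ,
  size (uncurry fromFrobenius) (map-enumerates (uncurry fromFrobenius)
                   (λ (pair , _) (pair′ , _) → fromFrobenius-injective pair pair′)
                   mountain⇒goodPartition (goodPartition⇒mountain _ n≥1) (mountains-enumerates n))
  where
  size : ∀ {Q} f → Enumerates Q (map f (mountains n)) → HasSize Q (length (mountains n))
  size f (unique , mem) = map f (mountains n) , unique , length-map f (mountains n) , mem
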